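{- Let $\mathcal{H}$ be a finite hypergraph with maximal vertex degree $\Delta$, such that every hyperedge of $\mathcal{H}$ contains at least $\delta$ vertices, where $\delta \ge 2$. Let $k = \lceil 2\Delta/\delta \rceil$. Then: (1) $\mathcal{H}$ admits a proper vertex coloring with $k+1$ colors; (2) if moreover $\delta \ge 3$ and $k \ge 3$, then $\mathcal{H}$ admits a proper vertex coloring with $k$ colors.
   Context: A hypergraph $\mathcal{H}$ consists of a vertex set $V(\mathcal{H})$ and a family $E(\mathcal{H})$ of subsets of $V(\mathcal{H})$ called hyperedges. The degree $d_{\mathcal{H}}(v)$ of a vertex $v$ is the number of hyperedges containing $v$; $\Delta$ is the maximum of these degrees. A vertex coloring of $\mathcal{H}$ is called proper if every hyperedge contains at least two vertices of different colors. -}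

module Defs where

open import Data.Nat using (ℕ; zero; suc; _+_; _*_; _∸_; _/_; _⊔_; _≤_)
open import Data.Fin using (Fin)
open import Data.Fin.Subset using (Subset; _∈_; ∣_∣)
open import Data.Fin.Subset.Properties using (_∈?_)
open import Data.List using (List; length; filter; foldr; map; allFin)
open import Data.List.Relation.Unary.All using (All)
open import Data.Product using (Σ; _×_)
open import Relation.Binary.PropositionalEquality using (_≢_)

-- A finite hypergraph on vertex set Fin n: a finite family (list, so
-- repeated hyperedges are allowed) of subsets of the vertex set.
record Hypergraph : Set where
  constructor hypergraph
  field
    n     : ℕ
    edges : List (Subset n)
open Hypergraph public

degree : (H : Hypergraph) → Fin (n H) → ℕ
degree H v = length (filter (v ∈?_) (edges H))

-- maximum vertex degree Δ (0 if there are no vertices)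
maxDegree : Hypergraph → ℕ
maxDegree H = foldr _⊔_ 0 (map (degree H) (allFin (n H)))

minEdgeSize≥ : Hypergraph → ℕ → Set
minEdgeSize≥ H δ = All (λ e → δ ≤ ∣ e ∣) (edges H)

-- ceiling division ⌈ a / b ⌉ (for b > 0; value 0 when b = 0, never used)
⌈_/_⌉ : ℕ → ℕ → ℕ
⌈ a / zero ⌉ = 0
⌈ a / suc b ⌉ = (a + b) / suc b

IsProperColoring : (H : Hypergraph) (c : ℕ) → (Fin (n H) → Fin c) → Set
IsProperColoring H c col =
  All (λ e → Σ (Fin (n H)) λ u → Σ (Fin (n H)) λ v →
         u ∈ e × v ∈ e × col u ≢ col v) (edges H)

ProperlyColorable : Hypergraph → ℕ → Set
ProperlyColorable H c = Σ (Fin (n H) → Fin c) (IsProperColoring H c)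

module Submission where

-- Both parts follow from one lemma (colourable): if every hyperedge has at
-- least δ ≥ 2 vertices and Δ ≤ (δ - 1) c, then c + 1 colours suffice.
-- Its proof has two steps.
--  * Remove the least vertex from every hyperedge.  The remaining sets have
--    ≥ δ - 1 elements and every vertex lies in ≤ (δ - 1) c of them, so by a
--    Hall-type theorem for bounded transversals (bounded-transversal, proved
--    by augmenting paths and a double-counting obstruction) every edge e
--    can pick a vertex a(e) ≠ min e such that each vertex is picked ≤ c times.
--  * Colour the vertices in increasing order, giving a(e) a colour different
--    from that of min e (greedy-colouring).  Each vertex has to avoid ≤ c
--    colours, so c + 1 colours suffice, and every edge e sees the distinct
--    colours of a(e) and min e.
-- The theorem then needs only the arithmetic 2Δ ≤ kδ ⇒ Δ ≤ (δ - 1) k, and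
-- Δ ≤ (δ - 1)(k - 1) when moreover δ, k ≥ 3.

open import Defs
open import Data.Nat
  using (ℕ; zero; suc; pred; _+_; _*_; _∸_; _≤_; _<_; _⊔_; _/_; _%_;
         z≤n; s≤s; s≤s⁻¹; >-nonZero)
open import Data.Nat.Properties
  using (≤-refl; ≤-reflexive; ≤-trans; <-irrefl; <-trans; <-≤-trans; n<1+n; m<n+m; n≢0⇒n>0;
         n≤1+n; m≤m+n; m≤n+m; m≤m⊔n; m≤n⊔m; ≮⇒≥; m≤n⇒m<n∨m≡n; _<?_;
         +-comm; +-identityʳ; *-identityʳ; *-zeroʳ; +-mono-≤; +-mono-<-≤;
         +-mono-≤-<; +-monoˡ-≤; +-monoʳ-≤; *-monoˡ-≤; *-monoʳ-≤; +-cancelʳ-≤;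
         *-cancelˡ-≤; *-cancelˡ-<; ∸-monoˡ-≤; suc-pred; +-*-semiring;
         module ≤-Reasoning)
  renaming (_≟_ to _≟ℕ_)
open import Data.Nat.DivMod using (m≡m%n+[m/n]*n; m%n<n)
open import Data.Nat.Solver using (module +-*-Solver)
open import Algebra.Properties.Semiring.Sum +-*-semiring
  using (sum; sum-cong-≗; sum-replicate-zero; sum-remove; ∑-comm;
         *-distribˡ-sum; *-distribʳ-sum)
open import Data.Bool using (Bool; true; false; _∨_; T)
open import Data.Bool.Properties using (T-∨; T-≡)
open import Data.Fin using (Fin; zero; suc; toℕ; fromℕ<; punchIn)
open import Data.Fin.Properties
  using (_≟_; any?; toℕ-fromℕ<; toℕ-injective; toℕ<n; punchInᵢ≢i; <⇒≢)
open import Data.Fin.Subset using (Subset; _∈_; ∣_∣)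
open import Data.Fin.Subset.Properties using (_∈?_)
open import Data.Vec using ([]; _∷_; lookup)
open import Data.Vec.Properties using (lookup⇒[]=)
open import Data.Vec.Functional as Vector using (updateAt; removeAt)
open import Data.Vec.Functional.Properties using (updateAt-updates; updateAt-minimal)
open import Data.List as List using (List; []; _∷_; length; filter; foldr)
open import Data.List.Membership.Propositional using () renaming (_∈_ to _∈ₗ_)
open import Data.List.Membership.Propositional.Properties using (∈-allFin; ∈-map⁺; ∈-lookup)
open import Data.List.Relation.Unary.All as All using (All)
open import Data.List.Relation.Unary.Any as Any using (here; there)
open import Data.List.Relation.Unary.Any.Properties using (lookup-index)
open import Data.Product using (Σ; ∃; _×_; _,_; proj₁; proj₂)
open import Data.Sum as Sum using (_⊎_; inj₁; inj₂)
open import Data.Empty using (⊥; ⊥-elim)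
open import Function using (_∘_; Equivalence)
open import Relation.Nullary using (¬_; Dec; yes; no; does; contradiction)
open import Relation.Nullary.Decidable using (⌊_⌋; T?; ¬?; decidable-stable; _×-dec_; toWitness; fromWitness; dec-true; dec-false)
open import Relation.Binary.PropositionalEquality
  using (_≡_; _≢_; _≗_; refl; sym; trans; cong; subst; module ≡-Reasoning)

open Equivalence using (to; from)

𝟙 : Bool → ℕ
𝟙 true = 1
𝟙 false = 0

𝟙≤1 : ∀ b → 𝟙 b ≤ 1
𝟙≤1 true = ≤-refl
𝟙≤1 false = z≤n

count : ∀ {n} → (Fin n → Bool) → ℕ
count A = sum (λ x → 𝟙 (A x))

_∈ᵇ_ : ∀ {n} → Fin n → Subset n → Bool
x ∈ᵇ S = lookup S x

size : ∀ {n} → Subset n → ℕ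
size S = count (_∈ᵇ S)

∣∣≡size : ∀ {n} (S : Subset n) → ∣ S ∣ ≡ size S
∣∣≡size [] = refl
∣∣≡size (true ∷ S) = cong suc (∣∣≡size S)
∣∣≡size (false ∷ S) = ∣∣≡size S

∈ᵇ⇒∈ : ∀ {n} {x : Fin n} {S : Subset n} → T (x ∈ᵇ S) → x ∈ S
∈ᵇ⇒∈ {x = x} {S} x∈S = lookup⇒[]= x S (to T-≡ x∈S)

∑-mono-≤ : ∀ {m} {f g : Fin m → ℕ} → (∀ i → f i ≤ g i) → sum f ≤ sum g
∑-mono-≤ {zero} f≤g = z≤n
∑-mono-≤ {suc m} f≤g = +-mono-≤ (f≤g zero) (∑-mono-≤ (f≤g ∘ suc))

∑-mono-< : ∀ {m} {f g : Fin m → ℕ} → (∀ i → f i ≤ g i) → ∀ i → f i < g i → sum f < sum g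
∑-mono-< f≤g zero fi<gi = +-mono-<-≤ fi<gi (∑-mono-≤ (f≤g ∘ suc))
∑-mono-< f≤g (suc i) fi<gi = +-mono-≤-< (f≤g zero) (∑-mono-< (f≤g ∘ suc) i fi<gi)


≤-∑ : ∀ {m} (f : Fin m → ℕ) i → f i ≤ sum f
≤-∑ f zero = m≤m+n _ _
≤-∑ f (suc i) = ≤-trans (≤-∑ (f ∘ suc) i) (m≤n+m _ _)

∑-positive : ∀ {m} (f : Fin m → ℕ) → (∀ i → 1 ≤ f i) → m ≤ sum f
∑-positive {zero} f pos = z≤n
∑-positive {suc m} f pos = +-mono-≤ (pos zero) (∑-positive (f ∘ suc) (pos ∘ suc))

count≤ : ∀ {n} (A : Fin n → Bool) → count A ≤ n
count≤ {zero} A = z≤n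
count≤ {suc n} A = +-mono-≤ (𝟙≤1 (A zero)) (count≤ (A ∘ suc))

count-⊂ : ∀ {n} (A B : Fin n → Bool) → (∀ x → T (A x) → T (B x)) →
  ∀ x → ¬ T (A x) → T (B x) → count A < count B
count-⊂ A B A⊆B x x∉A x∈B = ∑-mono-< (λ y → 𝟙-mono (A y) (B y) (A⊆B y)) x (𝟙-strict (A x) (B x) x∉A x∈B)
  where
  𝟙-mono : ∀ a b → (T a → T b) → 𝟙 a ≤ 𝟙 b
  𝟙-mono false b a⇒b = z≤n
  𝟙-mono true b a⇒b with b | a⇒b _
  ... | true | _ = ≤-refl
  𝟙-strict : ∀ a b → ¬ T a → T b → 𝟙 a < 𝟙 b
  𝟙-strict false true _ _ = ≤-refl
  𝟙-strict true b ¬a _ = ⊥-elim (¬a _)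

∑-point : ∀ {n} (y : Fin n) (g : Fin n → ℕ) → sum (λ x → 𝟙 (does (y ≟ x)) * g x) ≡ g y
∑-point {suc n} zero g = trans (cong (g zero + 0 +_) (sum-replicate-zero n))
                               (trans (+-identityʳ _) (+-identityʳ _))
∑-point {suc n} (suc y) g = ∑-point y (g ∘ suc)

∑-point-𝟙 : ∀ {n} (y : Fin n) → sum (λ x → 𝟙 (does (y ≟ x))) ≡ 1
∑-point-𝟙 {n} y = trans (sum-cong-≗ {n} (λ x → sym (*-identityʳ (𝟙 (does (y ≟ x)))))) (∑-point y (λ _ → 1))

∑-agree-off : ∀ {m} (f g : Fin m → ℕ) j → (∀ i → i ≢ j → f i ≡ g i) → sum f + g j ≡ sum g + f j
∑-agree-off {suc m} f g j agree = begin
  sum f + g j                      ≡⟨ cong (_+ g j) (sum-remove {i = j} f) ⟩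
  f j + sum (removeAt f j) + g j   ≡⟨ cong (λ s → f j + s + g j) (sum-cong-≗ rest) ⟩
  f j + sum (removeAt g j) + g j   ≡⟨ swap (f j) _ (g j) ⟩
  g j + sum (removeAt g j) + f j   ≡⟨ cong (_+ f j) (sum-remove {i = j} g) ⟨
  sum g + f j                      ∎
  where
  open ≡-Reasoning
  open +-*-Solver
  rest : removeAt f j ≗ removeAt g j
  rest k = agree (punchIn j k) (punchInᵢ≢i j k)
  swap : ∀ a s b → a + s + b ≡ b + s + a
  swap = solve 3 (λ a s b → a :+ s :+ b := b :+ s :+ a) refl

load : ∀ {m n} → (Fin m → Fin n) → Fin n → ℕ
load r x = sum (λ j → 𝟙 (does (r j ≟ x)))

∑-fibres : ∀ {m n} (r : Fin m → Fin n) (h : Fin n → ℕ) →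
  sum (λ j → h (r j)) ≡ sum (λ x → load r x * h x)
∑-fibres {m} {n} r h = begin
  sum (λ j → h (r j))                                  ≡⟨ sum-cong-≗ (λ j → sym (∑-point (r j) h)) ⟩
  sum (λ j → sum (λ x → 𝟙 (does (r j ≟ x)) * h x))    ≡⟨ ∑-comm (λ j x → 𝟙 (does (r j ≟ x)) * h x) ⟩
  sum (λ x → sum (λ j → 𝟙 (does (r j ≟ x)) * h x))    ≡⟨ sum-cong-≗ (λ x → sym (*-distribʳ-sum (h x) (λ j → 𝟙 (does (r j ≟ x))))) ⟩
  sum (λ x → load r x * h x)                           ∎
  where open ≡-Reasoning

_[_≔_] : ∀ {m n} → (Fin m → Fin n) → Fin m → Fin n → Fin m → Fin n
r [ j ≔ w ] = updateAt r j (λ _ → w)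

load-reassign : ∀ {m n} (r : Fin m → Fin n) j w x →
  load (r [ j ≔ w ]) x + 𝟙 (does (r j ≟ x)) ≡ load r x + 𝟙 (does (w ≟ x))
load-reassign {m} r j w x = begin
  load (r [ j ≔ w ]) x + 𝟙 (does (r j ≟ x))              ≡⟨ ∑-agree-off f′ f j agree ⟩
  load r x + 𝟙 (does ((r [ j ≔ w ]) j ≟ x))              ≡⟨ cong (λ y → load r x + 𝟙 (does (y ≟ x))) (updateAt-updates j r) ⟩
  load r x + 𝟙 (does (w ≟ x))                             ∎
  where
  open ≡-Reasoning
  f f′ : Fin m → ℕ
  f i = 𝟙 (does (r i ≟ x))
  f′ i = 𝟙 (does ((r [ j ≔ w ]) i ≟ x))
  agree : ∀ i → i ≢ j → f′ i ≡ f i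
  agree i i≢j = cong (λ y → 𝟙 (does (y ≟ x))) (updateAt-minimal i j r i≢j)

load-reassign-≤ : ∀ {m n} (r : Fin m → Fin n) j w x →
  load (r [ j ≔ w ]) x ≤ load r x + 𝟙 (does (w ≟ x))
load-reassign-≤ r j w x = ≤-trans (m≤m+n _ _) (≤-reflexive (load-reassign r j w x))

load-reassign-< : ∀ {m n} (r : Fin m → Fin n) j w → r j ≢ w →
  load (r [ j ≔ w ]) (r j) < load r (r j)
load-reassign-< r j w rj≢w = begin-strict
  load r′ (r j)                              <⟨ n<1+n _ ⟩
  suc (load r′ (r j))                        ≡⟨ +-comm 1 _ ⟩
  load r′ (r j) + 1                          ≡⟨ cong (λ b → load r′ (r j) + 𝟙 b) (dec-true (r j ≟ r j) refl) ⟨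
  load r′ (r j) + 𝟙 (does (r j ≟ r j))       ≡⟨ load-reassign r j w (r j) ⟩
  load r (r j) + 𝟙 (does (w ≟ r j))          ≡⟨ cong (λ b → load r (r j) + 𝟙 b) (dec-false (w ≟ r j) (rj≢w ∘ sym)) ⟩
  load r (r j) + 0                           ≡⟨ +-identityʳ _ ⟩
  load r (r j)                               ∎
  where
  open ≤-Reasoning
  r′ = r [ j ≔ w ]

-- Increasing chains of subsets of Fin n become stationary

Increasing : ∀ {n} → (ℕ → Fin n → Bool) → Set
Increasing A = ∀ i x → T (A i x) → T (A (suc i) x)

StableAt : ∀ {n} → (ℕ → Fin n → Bool) → ℕ → Set
StableAt A t = ∀ x → T (A (suc t) x) → T (A t x)

stable-or-grown : ∀ {n} (A : ℕ → Fin n → Bool) → Increasing A → ∀ i → ∃ (StableAt A) ⊎ i ≤ count (A i)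
stable-or-grown A inc zero = inj₂ z≤n
stable-or-grown A inc (suc i) with stable-or-grown A inc i
... | inj₁ stable = inj₁ stable
... | inj₂ grown with any? (λ x → T? (A (suc i) x) ×-dec ¬? (T? (A i x)))
...   | yes (x , new , x∉Aᵢ) = inj₂ (<-≤-trans (s≤s grown) (count-⊂ (A i) (A (suc i)) (inc i) x x∉Aᵢ new))
...   | no nothing-new = inj₁ (i , λ x x∈ → decidable-stable (T? (A i x)) (λ x∉ → nothing-new (x , x∈ , x∉)))

-- Since Fin n has only n points, some stage is stable.
chain-stabilises : ∀ {n} (A : ℕ → Fin n → Bool) → Increasing A → ∃ (StableAt A)
chain-stabilises {n} A inc with stable-or-grown A inc (suc n)
... | inj₁ stable = stable
... | inj₂ too-big = ⊥-elim (<-irrefl refl (<-≤-trans too-big (count≤ (A (suc n)))))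

-- Bounded transversals

IsTransversal : ∀ {m n} → ℕ → (Fin m → Subset n) → (Fin m → Fin n) → Set
IsTransversal c S r = (∀ j → T (r j ∈ᵇ S j)) × (∀ x → load r x ≤ c)

deg : ∀ {m n} → (Fin m → Subset n) → Fin n → ℕ
deg S x = sum (λ j → 𝟙 (x ∈ᵇ S j))

countIn : ∀ {n} → (Fin n → Bool) → Subset n → ℕ
countIn Z A = sum (λ x → 𝟙 (Z x) * 𝟙 (x ∈ᵇ A))

countIn-⊇ : ∀ {n} (Z : Fin n → Bool) (A : Subset n) → (∀ x → T (x ∈ᵇ A) → T (Z x)) → size A ≤ countIn Z A
countIn-⊇ Z A A⊆Z = ∑-mono-≤ (λ x → 𝟙-⊆ (x ∈ᵇ A) (Z x) (A⊆Z x))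
  where
  𝟙-⊆ : ∀ a z → (T a → T z) → 𝟙 a ≤ 𝟙 z * 𝟙 a
  𝟙-⊆ false z a⇒z = z≤n
  𝟙-⊆ true z a⇒z with z | a⇒z _
  ... | true | _ = ≤-refl

𝟙-guard : ∀ b {k s} → (T b → k ≤ s) → k * 𝟙 b ≤ s
𝟙-guard true {k} k≤s = ≤-trans (≤-reflexive (*-identityʳ k)) (k≤s _)
𝟙-guard false {k} k≤s = ≤-trans (≤-reflexive (*-zeroʳ k)) z≤n

𝟙-scale : ∀ b {k l} → (T b → k ≤ l) → k * 𝟙 b ≤ l * 𝟙 b
𝟙-scale true k≤l = *-monoˡ-≤ 1 (k≤l _)
𝟙-scale false {k} {l} k≤l = ≤-reflexive (trans (*-zeroʳ k) (sym (*-zeroʳ l)))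

-- Counting the pairs (x , j)
-- with x ∈ Z ∩ S j gives ≥ μ (1 + c |Z|) from the sizes and the loads, but
-- ≤ |Z| μ c from the degrees.
no-saturated-closed-set : ∀ {m n μ c} (S : Fin (suc m) → Subset n) (r : Fin m → Fin n) →
  1 ≤ μ → (∀ j → μ ≤ size (S j)) → (∀ x → deg S x ≤ μ * c) →
  (Z : Fin n → Bool) → (∀ x → T (x ∈ᵇ S zero) → T (Z x)) →
  (∀ j x → T (Z (r j)) → T (x ∈ᵇ S (suc j)) → T (Z x)) →
  (∀ x → T (Z x) → c ≤ load r x) → ⊥
no-saturated-closed-set {μ = μ} {c} S r μ≥1 big sparse Z S₀⊆Z closed saturated =
  <-irrefl refl (begin-strict
    μ * (c * N)                          <⟨ m<n+m _ μ≥1 ⟩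
    μ + μ * (c * N)                      ≤⟨ +-mono-≤ (≤-trans (big zero) (countIn-⊇ Z (S zero) S₀⊆Z))
                                                     (*-monoʳ-≤ μ cN≤hits) ⟩
    countIn Z (S zero) + μ * hits        ≤⟨ +-monoʳ-≤ (countIn Z (S zero)) μhits≤ ⟩
    sum (λ j → countIn Z (S j))          ≡⟨ pairs ⟩
    sum (λ x → 𝟙 (Z x) * deg S x)        ≤⟨ ∑-mono-≤ (λ x → *-monoʳ-≤ (𝟙 (Z x)) (sparse x)) ⟩
    sum (λ x → 𝟙 (Z x) * (μ * c))        ≡⟨ *-distribʳ-sum (μ * c) (𝟙 ∘ Z) ⟨
    N * (μ * c)                          ≡⟨ solve 3 (λ N μ c → N :* (μ :* c) := μ :* (c :* N)) refl N μ c ⟩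
    μ * (c * N)                          ∎)
  where
  open ≤-Reasoning
  open +-*-Solver
  N = count Z
  hits = sum (λ j → 𝟙 (Z (r j)))
  cN≤hits : c * N ≤ hits
  cN≤hits = begin
    c * N                                ≡⟨ *-distribˡ-sum c (𝟙 ∘ Z) ⟩
    sum (λ x → c * 𝟙 (Z x))              ≤⟨ ∑-mono-≤ (λ x → 𝟙-scale (Z x) (saturated x)) ⟩
    sum (λ x → load r x * 𝟙 (Z x))       ≡⟨ ∑-fibres r (𝟙 ∘ Z) ⟨
    hits                                 ∎
  μhits≤ : μ * hits ≤ sum (λ j → countIn Z (S (suc j)))
  μhits≤ = begin
    μ * hits                             ≡⟨ *-distribˡ-sum μ (λ j → 𝟙 (Z (r j))) ⟩
    sum (λ j → μ * 𝟙 (Z (r j)))          ≤⟨ ∑-mono-≤ (λ j → 𝟙-guard (Z (r j)) (λ rj∈Z →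
                                              ≤-trans (big (suc j)) (countIn-⊇ Z (S (suc j)) (λ x → closed j x rj∈Z)))) ⟩
    sum (λ j → countIn Z (S (suc j)))    ∎
  pairs : sum (λ j → countIn Z (S j)) ≡ sum (λ x → 𝟙 (Z x) * deg S x)
  pairs = trans (∑-comm (λ j x → 𝟙 (Z x) * 𝟙 (x ∈ᵇ S j)))
                (sum-cong-≗ (λ x → sym (*-distribˡ-sum (𝟙 (Z x)) (λ j → 𝟙 (x ∈ᵇ S j)))))

reassign-transversal : ∀ {m n c} {S : Fin m → Subset n} {r : Fin m → Fin n} j w →
  IsTransversal c S r → T (w ∈ᵇ S j) → load r w < c → IsTransversal c S (r [ j ≔ w ])
reassign-transversal {c = c} {S = S} {r} j w (r∈S , r≤c) w∈Sj w-free = picks , bounded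
  where
  picks : ∀ i → T ((r [ j ≔ w ]) i ∈ᵇ S i)
  picks i with i ≟ j
  ... | yes refl = subst (λ y → T (y ∈ᵇ S i)) (sym (updateAt-updates i r)) w∈Sj
  ... | no i≢j = subst (λ y → T (y ∈ᵇ S i)) (sym (updateAt-minimal i j r i≢j)) (r∈S i)
  bounded : ∀ x → load (r [ j ≔ w ]) x ≤ c
  bounded x = ≤-trans (load-reassign-≤ r j w x) (gain-fits (w ≟ x))
    where
    gain-fits : (w≟x : Dec (w ≡ x)) → load r x + 𝟙 (does w≟x) ≤ c
    gain-fits (yes refl) = subst (_≤ c) (+-comm 1 _) w-free
    gain-fits (no _) = ≤-trans (≤-reflexive (+-identityʳ _)) (r≤c x)

-- Adding the member S zero to a transversal r of the members S (suc j).
module Extension {m n : ℕ} (c : ℕ) (S : Fin (suc m) → Subset n) where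

  -- Reach r i x: x is reachable from S zero by an alternating path of length
  -- ≤ i, i.e. x ∈ S zero, or x ∈ S (suc j) for an index j whose
  -- representative r j is reachable.
  Reach : (Fin m → Fin n) → ℕ → Fin n → Bool

  Step : (Fin m → Fin n) → ℕ → Fin n → Set
  Step r i x = ∃ λ j → T (Reach r i (r j)) × T (x ∈ᵇ S (suc j))

  step? : ∀ r i x → Dec (Step r i x)
  step? r i x = any? (λ j → T? (Reach r i (r j)) ×-dec T? (x ∈ᵇ S (suc j)))

  Reach r zero x = x ∈ᵇ S zero
  Reach r (suc i) x = Reach r i x ∨ ⌊ step? r i x ⌋

  reach-old : ∀ r i x → T (Reach r i x) → T (Reach r (suc i) x)
  reach-old r i x x∈ = from (T-∨ {Reach r i x}) (inj₁ x∈)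

  reach-new : ∀ r i j x → T (Reach r i (r j)) → T (x ∈ᵇ S (suc j)) → T (Reach r (suc i) x)
  reach-new r i j x rj∈ x∈Sj =
    from (T-∨ {Reach r i x}) (inj₂ (fromWitness {a? = step? r i x} (j , rj∈ , x∈Sj)))

  reach-inv : ∀ r i x → T (Reach r (suc i) x) →
    T (Reach r i x) ⊎ Step r i x
  reach-inv r i x x∈ = Sum.map₂ (toWitness {a? = step? r i x}) (to (T-∨ {Reach r i x}) x∈)

  reach-start : ∀ r i x → T (x ∈ᵇ S zero) → T (Reach r i x)
  reach-start r zero x x∈S₀ = x∈S₀
  reach-start r (suc i) x x∈S₀ = reach-old r i x (reach-start r i x x∈S₀)

  -- Moving index j to a vertex w ∈ S (suc j) that is not reachable in i
  -- steps keeps the first i layers: index j only matters once r j is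
  -- reached, and then w would be reached one step later.
  reach-reassign : ∀ r i j w → T (w ∈ᵇ S (suc j)) → ¬ T (Reach r i w) →
    ∀ x → T (Reach r i x) → T (Reach (r [ j ≔ w ]) i x)
  reach-reassign r zero j w w∈Sj w∉ x x∈ = x∈
  reach-reassign r (suc i) j w w∈Sj w∉ x x∈ with reach-inv r i x x∈
  ... | inj₁ x∈Rᵢ = reach-old _ i x (reach-reassign r i j w w∈Sj (w∉ ∘ reach-old r i w) x x∈Rᵢ)
  ... | inj₂ (j′ , rj′∈ , x∈Sj′) with j′ ≟ j
  ...   | yes refl = contradiction (reach-new r i j w rj′∈ w∈Sj) w∉
  ...   | no j′≢j = reach-new _ i j′ x
          (subst (λ y → T (Reach (r [ j ≔ w ]) i y)) (sym (updateAt-minimal j′ j r j′≢j))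
            (reach-reassign r i j w w∈Sj (w∉ ∘ reach-old r i w) (r j′) rj′∈))
          x∈Sj′

  -- Augmenting path: a reachable vertex w with spare capacity lets S zero
  -- join.  If w ∈ S (suc j) was reached through r j, move j to w; then r j
  -- has spare capacity and is reachable in fewer steps.
  augment : ∀ i r → IsTransversal c (S ∘ suc) r → ∀ w → T (Reach r i w) → load r w < c →
    ∃ (IsTransversal c S)
  augment zero r (r∈S , r≤c) w w∈S₀ w-free = (w Vector.∷ r) , picks , bounded
    where
    picks : ∀ j → T ((w Vector.∷ r) j ∈ᵇ S j)
    picks zero = w∈S₀
    picks (suc j) = r∈S j
    bounded : ∀ x → 𝟙 (does (w ≟ x)) + load r x ≤ c
    bounded x with w ≟ x
    ... | yes refl = w-free
    ... | no _ = r≤c x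
  augment (suc i) r t w w∈ w-free with T? (Reach r i w)
  ... | yes w∈Rᵢ = augment i r t w w∈Rᵢ w-free
  ... | no w∉Rᵢ with reach-inv r i w w∈
  ...   | inj₁ w∈Rᵢ = contradiction w∈Rᵢ w∉Rᵢ
  ...   | inj₂ (j , rj∈ , w∈Sj) =
    augment i (r [ j ≔ w ]) (reassign-transversal {S = S ∘ suc} j w t w∈Sj w-free) (r j)
      (reach-reassign r i j w w∈Sj w∉Rᵢ (r j) rj∈)
      (<-≤-trans (load-reassign-< r j w rj≢w) (proj₂ t (r j)))
    where
    rj≢w : r j ≢ w
    rj≢w rj≡w = w∉Rᵢ (subst (T ∘ Reach r i) rj≡w rj∈)

  -- Either some reachable vertex has spare capacity, or the stable reachable
  -- set is a saturated closed set, which double counting excludes.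
  extend : ∀ {μ} → 1 ≤ μ → (∀ j → μ ≤ size (S j)) → (∀ x → deg S x ≤ μ * c) →
    ∀ r → IsTransversal c (S ∘ suc) r → ∃ (IsTransversal c S)
  extend μ≥1 big sparse r t with chain-stabilises (Reach r) (reach-old r)
  ... | s , stable with any? (λ w → T? (Reach r s w) ×-dec (load r w <? c))
  ...   | yes (w , w∈ , w-free) = augment s r t w w∈ w-free
  ...   | no all-full = ⊥-elim (no-saturated-closed-set S r μ≥1 big sparse (Reach r s)
            (reach-start r s) (λ j x rj∈ x∈Sj → stable x (reach-new r s j x rj∈ x∈Sj))
            (λ x x∈ → ≮⇒≥ (λ free → all-full (x , x∈ , free))))

bounded-transversal : ∀ {m n} μ c → 1 ≤ μ → (S : Fin m → Subset n) →
  (∀ j → μ ≤ size (S j)) → (∀ x → deg S x ≤ μ * c) → ∃ (IsTransversal c S)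
bounded-transversal {zero} μ c μ≥1 S big sparse = (λ ()) , (λ ()) , (λ x → z≤n)
bounded-transversal {suc m} μ c μ≥1 S big sparse with
  bounded-transversal μ c μ≥1 (S ∘ suc) (big ∘ suc) (λ x → ≤-trans (m≤n+m _ _) (sparse x))
... | r , t = Extension.extend c S μ≥1 big sparse r t

-- Greedy colouring along the vertex order

free-colour : ∀ {m c} (P : Fin m → Bool) (g : Fin m → Fin (suc c)) → count P ≤ c →
  ∃ λ β → ∀ j → T (P j) → g j ≢ β
free-colour {m} {c} P g few = unused-colour (any? (λ β → hits β ≟ℕ 0))
  where
  hits : Fin (suc c) → ℕ
  hits β = sum (λ j → 𝟙 (P j) * 𝟙 (does (g j ≟ β)))

  -- each selected index has exactly one colour
  total-hits : sum hits ≡ count P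
  total-hits = begin
    sum hits                                              ≡⟨ ∑-comm (λ β j → 𝟙 (P j) * 𝟙 (does (g j ≟ β))) ⟩
    sum (λ j → sum (λ β → 𝟙 (P j) * 𝟙 (does (g j ≟ β))))  ≡⟨ sum-cong-≗ (λ j → *-distribˡ-sum (𝟙 (P j)) (λ β → 𝟙 (does (g j ≟ β)))) ⟨
    sum (λ j → 𝟙 (P j) * sum (λ β → 𝟙 (does (g j ≟ β))))  ≡⟨ sum-cong-≗ (λ j → cong (𝟙 (P j) *_) (∑-point-𝟙 (g j))) ⟩
    sum (λ j → 𝟙 (P j) * 1)                               ≡⟨ sum-cong-≗ (λ j → *-identityʳ (𝟙 (P j))) ⟩
    count P                                               ∎
    where open ≡-Reasoning

  selected-hit : ∀ j β → T (P j) → g j ≡ β → 1 ≤ hits β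
  selected-hit j β Pj gj≡β = ≤-trans (≤-reflexive (sym term≡1)) (≤-∑ (λ i → 𝟙 (P i) * 𝟙 (does (g i ≟ β))) j)
    where
    term≡1 : 𝟙 (P j) * 𝟙 (does (g j ≟ β)) ≡ 1
    term≡1 rewrite to T-≡ Pj | dec-true (g j ≟ β) gj≡β = refl

  unused-colour : Dec (∃ λ β → hits β ≡ 0) → ∃ λ β → ∀ j → T (P j) → g j ≢ β
  unused-colour (yes (β , unused)) = β , λ j Pj gj≡β → <-irrefl (sym unused) (selected-hit j β Pj gj≡β)
  unused-colour (no all-used) = ⊥-elim (<-irrefl refl (begin-strict
    c              <⟨ n<1+n c ⟩
    suc c          ≤⟨ ∑-positive hits (λ β → n≢0⇒n>0 (λ h → all-used (β , h))) ⟩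
    sum hits       ≡⟨ total-hits ⟩
    count P        ≤⟨ few ⟩
    c              ∎))
    where open ≤-Reasoning

-- Colour the vertices one by one in increasing order.  If every constraint j
-- asks for different colours at a j and at an earlier vertex p j, and every
-- vertex is the later end a j of at most c constraints, then when a vertex
-- is coloured at most c colours are forbidden, so c + 1 colours suffice.
module GreedyColouring {m n c : ℕ} (a p : Fin m → Fin n)
    (p<a : ∀ j → toℕ (p j) < toℕ (a j)) (few : ∀ x → load a x ≤ c) where

  RespectsBelow : ℕ → (Fin n → Fin (suc c)) → Set
  RespectsBelow t col = ∀ j → toℕ (a j) < t → col (a j) ≢ col (p j)

  colour-prefix : ∀ t → t ≤ n → ∃ (RespectsBelow t)
  colour-prefix zero _ = (λ _ → zero) , λ j ()
  colour-prefix (suc t) t<n with colour-prefix t (≤-trans (n≤1+n t) t<n)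
  ... | col , respects = col [ v ≔ β ] , respects′
    where
    v : Fin n
    v = fromℕ< t<n

    chosen : ∃ λ β → ∀ j → T (does (a j ≟ v)) → col (p j) ≢ β
    chosen = free-colour (λ j → does (a j ≟ v)) (col ∘ p) (few v)

    β : Fin (suc c)
    β = proj₁ chosen

    avoids : ∀ j → T (does (a j ≟ v)) → col (p j) ≢ β
    avoids = proj₂ chosen

    before-v : ∀ x → toℕ x < t → x ≢ v
    before-v x x<t = <⇒≢ (subst (toℕ x <_) (sym (toℕ-fromℕ< t<n)) x<t)

    unchanged : ∀ x → toℕ x < t → (col [ v ≔ β ]) x ≡ col x
    unchanged x x<t = updateAt-minimal x v col (before-v x x<t)

    respects′ : RespectsBelow (suc t) (col [ v ≔ β ])
    respects′ j aj≤t with a j ≟ v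
    ... | yes aj≡v = λ eq → avoids j (from T-≡ (dec-true (a j ≟ v) aj≡v))
                             (trans (sym (unchanged (p j) pj<t)) (trans (sym eq) new-colour))
      where
      pj<t : toℕ (p j) < t
      pj<t = <-≤-trans (p<a j) (subst (_≤ t) (cong toℕ (sym aj≡v)) (≤-reflexive (toℕ-fromℕ< t<n)))
      new-colour : (col [ v ≔ β ]) (a j) ≡ β
      new-colour = trans (cong (col [ v ≔ β ]) aj≡v) (updateAt-updates v col)
    ... | no aj≢v = λ eq → respects j aj<t
                             (trans (sym (unchanged (a j) aj<t)) (trans eq (unchanged (p j) (<-trans (p<a j) aj<t))))
      where
      aj<t : toℕ (a j) < t
      aj<t with m≤n⇒m<n∨m≡n (s≤s⁻¹ aj≤t)
      ... | inj₁ aj<t = aj<t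
      ... | inj₂ aj≡t = contradiction (toℕ-injective (trans aj≡t (sym (toℕ-fromℕ< t<n)))) aj≢v

  greedy-colouring : ∃ λ (col : Fin n → Fin (suc c)) → ∀ j → col (a j) ≢ col (p j)
  greedy-colouring with colour-prefix n ≤-refl
  ... | col , respects = col , λ j → respects j (toℕ<n (a j))

dropMin : ∀ {n} → Subset n → Subset n
dropMin [] = []
dropMin (true ∷ e) = false ∷ e
dropMin (false ∷ e) = false ∷ dropMin e

dropMin-⊆ : ∀ {n} (e : Subset n) x → T (x ∈ᵇ dropMin e) → T (x ∈ᵇ e)
dropMin-⊆ (true ∷ e) (suc x) x∈ = x∈
dropMin-⊆ (false ∷ e) (suc x) x∈ = dropMin-⊆ e x x∈

dropMin-below : ∀ {n} (e : Subset n) x → T (x ∈ᵇ dropMin e) → ∃ λ y → T (y ∈ᵇ e) × toℕ y < toℕ x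
dropMin-below (true ∷ e) (suc x) x∈ = zero , _ , s≤s z≤n
dropMin-below (false ∷ e) (suc x) x∈ with dropMin-below e x x∈
... | y , y∈e , y<x = suc y , y∈e , s≤s y<x

size-dropMin : ∀ {n} (e : Subset n) → size e ≤ suc (size (dropMin e))
size-dropMin [] = z≤n
size-dropMin (true ∷ e) = ≤-refl
size-dropMin (false ∷ e) = size-dropMin e

deg-shrink : ∀ {n} (K : Subset n → Subset n) → (∀ e x → T (x ∈ᵇ K e) → T (x ∈ᵇ e)) →
  ∀ (es : List (Subset n)) x → deg (λ j → K (List.lookup es j)) x ≤ length (filter (x ∈?_) es)
deg-shrink K K⊆ [] x = z≤n
deg-shrink K K⊆ (e ∷ es) x with x ∈? e
... | yes _ = +-mono-≤ (𝟙≤1 (x ∈ᵇ K e)) (deg-shrink K K⊆ es x)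
... | no x∉e = +-mono-≤ (𝟙-absent (x ∈ᵇ K e) (x∉e ∘ ∈ᵇ⇒∈ ∘ K⊆ e x)) (deg-shrink K K⊆ es x)
  where
  𝟙-absent : ∀ b → ¬ T b → 𝟙 b ≤ 0
  𝟙-absent false _ = z≤n
  𝟙-absent true ¬b = contradiction _ ¬b

⊔-upper : ∀ {x} {xs : List ℕ} → x ∈ₗ xs → x ≤ foldr _⊔_ 0 xs
⊔-upper (here refl) = m≤m⊔n _ _
⊔-upper (there x∈xs) = ≤-trans (⊔-upper x∈xs) (m≤n⊔m _ _)

degree≤maxDegree : ∀ H x → degree H x ≤ maxDegree H
degree≤maxDegree H x = ⊔-upper (∈-map⁺ (degree H) (∈-allFin x))

All-by-index : ∀ {A : Set} {P : A → Set} (xs : List A) → (∀ i → P (List.lookup xs i)) → All P xs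
All-by-index {P = P} xs P-at = All.tabulate λ x∈xs → subst P (sym (lookup-index x∈xs)) (P-at (Any.index x∈xs))

-- Each hyperedge e picks a
-- vertex a(e) other than its minimum, each vertex picked ≤ c times, and
-- a(e) is coloured differently from min e.
colourable : ∀ H δ c → 2 ≤ δ → minEdgeSize≥ H δ → maxDegree H ≤ (δ ∸ 1) * c →
  ProperlyColorable H (suc c)
colourable H δ c δ≥2 big Δ≤ = col , All-by-index (edges H) proper-at
  where
  es = edges H
  S : Fin (length es) → Subset (n H)
  S j = dropMin (List.lookup es j)

  reduced-big : ∀ j → δ ∸ 1 ≤ size (S j)
  reduced-big j = ∸-monoˡ-≤ 1 (begin
    δ                       ≤⟨ All.lookup big (∈-lookup j) ⟩
    ∣ List.lookup es j ∣    ≡⟨ ∣∣≡size (List.lookup es j) ⟩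
    size (List.lookup es j) ≤⟨ size-dropMin (List.lookup es j) ⟩
    suc (size (S j))        ∎)
    where open ≤-Reasoning

  reduced-sparse : ∀ x → deg S x ≤ (δ ∸ 1) * c
  reduced-sparse x = ≤-trans (deg-shrink dropMin dropMin-⊆ es x) (≤-trans (degree≤maxDegree H x) Δ≤)

  transversal : ∃ (IsTransversal c S)
  transversal = bounded-transversal (δ ∸ 1) c (∸-monoˡ-≤ 1 δ≥2) S reduced-big reduced-sparse

  a : Fin (length es) → Fin (n H)
  a = proj₁ transversal

  a∈S : ∀ j → T (a j ∈ᵇ S j)
  a∈S = proj₁ (proj₂ transversal)

  below : ∀ j → ∃ λ y → T (y ∈ᵇ List.lookup es j) × toℕ y < toℕ (a j)
  below j = dropMin-below (List.lookup es j) (a j) (a∈S j)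

  p : Fin (length es) → Fin (n H)
  p j = proj₁ (below j)

  colouring : ∃ λ (col : Fin (n H) → Fin (suc c)) → ∀ j → col (a j) ≢ col (p j)
  colouring = GreedyColouring.greedy-colouring a p (λ j → proj₂ (proj₂ (below j))) (proj₂ (proj₂ transversal))

  col : Fin (n H) → Fin (suc c)
  col = proj₁ colouring

  proper-at : ∀ j → Σ (Fin (n H)) λ u → Σ (Fin (n H)) λ v →
    u ∈ List.lookup es j × v ∈ List.lookup es j × col u ≢ col v
  proper-at j = a j , p j , ∈ᵇ⇒∈ (dropMin-⊆ (List.lookup es j) (a j) (a∈S j)) ,
                ∈ᵇ⇒∈ (proj₁ (proj₂ (below j))) , proj₂ colouring j

-- Arithmetic of k = ⌈ 2Δ / δ ⌉

-- ⌈ a / δ ⌉ δ ≥ a, as a + (δ - 1) = q δ + ρ with ρ < δ for q = ⌈ a / δ ⌉.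
ceil-div-mul : ∀ a δ → 1 ≤ δ → a ≤ ⌈ a / δ ⌉ * δ
ceil-div-mul a (suc b) (s≤s z≤n) = +-cancelʳ-≤ b a (q * suc b) (begin
  a + b                         ≡⟨ m≡m%n+[m/n]*n (a + b) (suc b) ⟩
  (a + b) % suc b + q * suc b   ≤⟨ +-monoˡ-≤ (q * suc b) (s≤s⁻¹ (m%n<n (a + b) (suc b))) ⟩
  b + q * suc b                 ≡⟨ +-comm b (q * suc b) ⟩
  q * suc b + b                 ∎)
  where
  open ≤-Reasoning
  q = (a + b) / suc b

-- From 2Δ ≤ kδ and δ ≥ 2: Δ ≤ (δ - 1) k, as δ ≤ 2 (δ - 1).
Δ≤[δ-1]k : ∀ Δ δ k → 2 ≤ δ → 2 * Δ ≤ k * δ → Δ ≤ (δ ∸ 1) * k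
Δ≤[δ-1]k Δ (suc (suc d)) k (s≤s (s≤s z≤n)) 2Δ≤kδ = *-cancelˡ-≤ 2 (begin
  2 * Δ                     ≤⟨ 2Δ≤kδ ⟩
  k * (2 + d)               ≤⟨ m≤m+n _ (k * d) ⟩
  k * (2 + d) + k * d       ≡⟨ solve 2 (λ k d → k :* (con 2 :+ d) :+ k :* d := con 2 :* ((con 1 :+ d) :* k)) refl k d ⟩
  2 * ((1 + d) * k)         ∎)
  where
  open ≤-Reasoning
  open +-*-Solver

-- From 2Δ ≤ kδ and δ, k ≥ 3: Δ ≤ (δ - 1)(k - 1), as kδ ≤ 2 (δ - 1)(k - 1) + 1
-- and 2Δ is even.
Δ≤[δ-1][k-1] : ∀ Δ δ k → 3 ≤ δ → 3 ≤ k → 2 * Δ ≤ k * δ → Δ ≤ (δ ∸ 1) * pred k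
Δ≤[δ-1][k-1] Δ (suc (suc (suc d))) (suc (suc (suc e))) (s≤s (s≤s (s≤s z≤n))) (s≤s (s≤s (s≤s z≤n))) 2Δ≤kδ =
  s≤s⁻¹ (*-cancelˡ-< 2 Δ (suc X) (begin-strict
    2 * Δ                                       ≤⟨ 2Δ≤kδ ⟩
    (3 + e) * (3 + d)                           ≤⟨ m≤m+n _ (e + d + e * d) ⟩
    (3 + e) * (3 + d) + (e + d + e * d)         <⟨ n<1+n _ ⟩
    suc ((3 + e) * (3 + d) + (e + d + e * d))   ≡⟨ solve 2 (λ e d → con 1 :+ ((con 3 :+ e) :* (con 3 :+ d) :+ (e :+ d :+ e :* d))
                                                      := con 2 :* (con 1 :+ (con 2 :+ d) :* (con 2 :+ e))) refl e d ⟩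
    2 * suc X                                   ∎))
  where
  open ≤-Reasoning
  open +-*-Solver
  X = (2 + d) * (2 + e)

theorem1 : (H : Hypergraph) (δ : ℕ) → 2 ≤ δ → minEdgeSize≥ H δ →
    ProperlyColorable H (suc ⌈ 2 * maxDegree H / δ ⌉)
    × (3 ≤ δ → 3 ≤ ⌈ 2 * maxDegree H / δ ⌉ →
       ProperlyColorable H ⌈ 2 * maxDegree H / δ ⌉)
theorem1 H δ δ≥2 big = with-k-colours , with-k-1-colours
  where
  Δ = maxDegree H
  k = ⌈ 2 * Δ / δ ⌉

  2Δ≤kδ : 2 * Δ ≤ k * δ
  2Δ≤kδ = ceil-div-mul (2 * Δ) δ (≤-trans (s≤s z≤n) δ≥2)

  with-k-colours : ProperlyColorable H (suc k)
  with-k-colours = colourable H δ k δ≥2 big (Δ≤[δ-1]k Δ δ k δ≥2 2Δ≤kδ)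

  with-k-1-colours : 3 ≤ δ → 3 ≤ k → ProperlyColorable H k
  with-k-1-colours δ≥3 k≥3 = subst (ProperlyColorable H) (suc-pred k {{>-nonZero (≤-trans (s≤s z≤n) k≥3)}})
    (colourable H δ (pred k) δ≥2 big (Δ≤[δ-1][k-1] Δ δ k δ≥3 k≥3 2Δ≤kδ))
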